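{- Consider an application of a hypersequent rule $(r)$ with premisses $G\mid C_1,\dots,G\mid C_n$ and conclusion $G\mid H$, where $G,H$ are hypersequents and $C_1,\dots,C_n$ sequents. Let $c\ge 0$ and $d\ge 0$ be natural numbers and let $\mathbb L_d=\{G\mid (H)^c\mid (C_1)^{x_1}\mid\dots\mid (C_n)^{x_n} : \sum_{i=1}^n x_i=d\}$. Then for every natural number $e$ with $0\le e\le d$, each element of $\mathbb L_{(d-e)}=\{G\mid (H)^{c+e}\mid (C_1)^{x'_1}\mid\dots\mid (C_n)^{x'_n} : \sum_{i=1}^n x'_i=d-e\}$ is derivable from hypersequents in $\mathbb L_d$ using only applications of the rule $(r)$.
   Context: Hypersequents are multisets of sequents separated by $\mid$. For a hypersequent $H$ and $u\ge 0$, $(H)^u$ denotes $H\mid\dots\mid H$ with $u$ copies of $H$ (empty if $u=0$). The rule $(r)$ is external-context-sharing: it may be applied with any hypersequent context in place of $G$ (the same context in all premisses and in the conclusion). -}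

module Defs where

open import Data.Nat using (ℕ; zero; suc; _+_)
open import Data.Fin using (Fin; zero; suc)
open import Data.List using (List; []; _∷_; _++_; [_])
open import Data.List.Relation.Binary.Permutation.Propositional using (_↭_)
open import Data.Product using (∃; _×_)
open import Relation.Binary.PropositionalEquality using (_≡_)

-- Hypersequents over an abstract type S of sequents: finite lists of
-- sequents, identified up to permutation (_↭_), i.e. multisets.
Hyp : Set → Set
Hyp S = List S

pow : {S : Set} → Hyp S → ℕ → Hyp S
pow H zero    = []
pow H (suc u) = H ++ pow H u

sumFin : (n : ℕ) → (Fin n → ℕ) → ℕ
sumFin zero    x = 0
sumFin (suc n) x = x zero + sumFin n (λ i → x (suc i))

powC : {S : Set} (n : ℕ) → (Fin n → S) → (Fin n → ℕ) → Hyp S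
powC zero    C x = []
powC (suc n) C x = pow [ C zero ] (x zero) ++ powC n (λ i → C (suc i)) (λ i → x (suc i))

-- Hypersequents are multisets, so derivations are closed under _↭_.
data Deriv {S : Set} (n : ℕ) (C : Fin n → S) (H : Hyp S)
           (Ass : Hyp S → Set) : Hyp S → Set where
  assum : ∀ {h} → Ass h → Deriv n C H Ass h
  rule  : (G' : Hyp S) → (∀ i → Deriv n C H Ass (G' ++ [ C i ])) →
          Deriv n C H Ass (G' ++ H)
  perm  : ∀ {h h'} → h ↭ h' → Deriv n C H Ass h → Deriv n C H Ass h'

L : {S : Set} (n : ℕ) (C : Fin n → S) (G H : Hyp S) (m k : ℕ) → Hyp S → Set
L n C G H m k h = ∃ λ x → (sumFin n x ≡ k) × (h ↭ (G ++ pow H m ++ powC n C x))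

module Submission where

-- Write bump x i for the exponent vector x with x_i raised by
-- one.  A single application of (r) with context K | (C_1)^{x_1} | ... |
-- (C_n)^{x_n} turns the n hypersequents K | (C_1)^{x_1} | ... | C_i | ... ,
-- i.e. K | powC (bump x i), into K | H | powC x: one copy of H is gained
-- and the total C-exponent drops by one.  Since bump x i has exponent sum
-- one larger than x, induction on e proves the theorem: for e = 0 the
-- target lies in L_d itself, and for e + 1 the premisses needed for the
-- target with sum d - (e + 1) are hypersequents with H-power c + e and
-- exponent sum d - e, derivable by the induction hypothesis.

open import Defs
open import Data.Nat using (ℕ; zero; suc; _+_; _∸_; _≤_)
open import Data.Nat.Properties using (+-suc; +-identityʳ; +-∸-assoc; ≤-trans; n≤1+n)
open import Data.Fin using (Fin; zero; suc)
open import Data.Vec.Functional using (updateAt)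
open import Data.List using (_++_; [_]; _∷_)
open import Data.List.Properties using (++-assoc)
open import Data.Product using (_,_)
open import Data.List.Relation.Binary.Permutation.Propositional
  using (_↭_; ↭-refl; ↭-sym; ↭-trans; ↭-reflexive)
open import Data.List.Relation.Binary.Permutation.Propositional.Properties
  using (++⁺ˡ; ++-comm; shift; shifts)
open import Relation.Binary.PropositionalEquality
  using (_≡_; refl; cong; subst; module ≡-Reasoning)
  renaming (sym to ≡-sym; trans to ≡-trans)

bump : {n : ℕ} → (Fin n → ℕ) → Fin n → Fin n → ℕ
bump x i = updateAt x i suc

sumFin-bump : (n : ℕ) (x : Fin n → ℕ) (i : Fin n) →
  sumFin n (bump x i) ≡ suc (sumFin n x)
sumFin-bump (suc n) x zero    = refl
sumFin-bump (suc n) x (suc i) = begin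
  x zero + sumFin n (bump (λ k → x (suc k)) i)  ≡⟨ cong (x zero +_) (sumFin-bump n _ i) ⟩
  x zero + suc (sumFin n (λ k → x (suc k)))     ≡⟨ +-suc (x zero) _ ⟩
  suc (sumFin (suc n) x)                        ∎
  where open ≡-Reasoning

powC-bump : {S : Set} (n : ℕ) (C : Fin n → S) (x : Fin n → ℕ) (i : Fin n) →
  powC n C (bump x i) ↭ C i ∷ powC n C x
powC-bump (suc n) C x zero    = ↭-refl
powC-bump (suc n) C x (suc i) =
  ↭-trans (++⁺ˡ (pow [ C zero ] (x zero))
                (powC-bump n (λ k → C (suc k)) (λ k → x (suc k)) i))
          (shift (C (suc i)) (pow [ C zero ] (x zero)) _)

trade-for-H : {S : Set} {n : ℕ} {C : Fin n → S} {H : Hyp S} {Ass : Hyp S → Set}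
  (K : Hyp S) (x : Fin n → ℕ) →
  (∀ i → Deriv n C H Ass (K ++ powC n C (bump x i))) →
  Deriv n C H Ass (K ++ H ++ powC n C x)
trade-for-H {n = n} {C} {H} K x premisses =
  perm conclusion (rule (K ++ Q) (λ i → perm (premiss i) (premisses i)))
  where
  Q = powC n C x
  premiss : ∀ i → K ++ powC n C (bump x i) ↭ (K ++ Q) ++ [ C i ]
  premiss i = ↭-sym (↭-trans (↭-reflexive (++-assoc K Q [ C i ]))
                     (++⁺ˡ K (↭-trans (++-comm Q [ C i ]) (↭-sym (powC-bump n C x i)))))
  conclusion : (K ++ Q) ++ H ↭ K ++ H ++ Q
  conclusion = ↭-trans (↭-reflexive (++-assoc K Q H)) (++⁺ˡ K (++-comm Q H))

absorb-H : {S : Set} (G H Q : Hyp S) (m : ℕ) →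
  (G ++ pow H m) ++ H ++ Q ↭ G ++ pow H (suc m) ++ Q
absorb-H G H Q m =
  ↭-trans (↭-reflexive (++-assoc G (pow H m) (H ++ Q)))
          (++⁺ˡ G (↭-trans (shifts (pow H m) H)
                           (↭-reflexive (≡-sym (++-assoc H (pow H m) Q)))))

lemma5 : {S : Set} (n : ℕ) (C : Fin n → S) (G H : Hyp S) (c d : ℕ) →
    (e : ℕ) → e ≤ d → (x′ : Fin n → ℕ) → sumFin n x′ ≡ d ∸ e →
    Deriv n C H (L n C G H c d) (G ++ pow H (c + e) ++ powC n C x′)
-- e = 0: the target is itself a member of L_d.
lemma5 n C G H c d zero _ x′ sum≡ rewrite +-identityʳ c = assum (x′ , sum≡ , ↭-refl)
lemma5 n C G H c d (suc e) e<d x′ sum≡ rewrite +-suc c e =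
  perm (absorb-H G H (powC n C x′) (c + e))
       (trade-for-H (G ++ pow H (c + e)) x′ premiss)
  where
  -- d ∸ e = suc (d ∸ suc e), so bump x′ i has the sum required one level up
  bumped-sum : ∀ i → sumFin n (bump x′ i) ≡ d ∸ e
  bumped-sum i = ≡-trans (sumFin-bump n x′ i) (≡-trans (cong suc sum≡) (≡-sym (+-∸-assoc 1 e<d)))
  premiss : ∀ i → Deriv n C H (L n C G H c d) ((G ++ pow H (c + e)) ++ powC n C (bump x′ i))
  premiss i = subst (Deriv n C H (L n C G H c d)) (≡-sym (++-assoc G _ _))
    (lemma5 n C G H c d e (≤-trans (n≤1+n e) e<d) (bump x′ i) (bumped-sum i))
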